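{- For all sets $A,B$, if $A\leq_{bT}B$ then $A^{b_0}\leq_1 B^{b_0}$.
   Context: Let $\varphi_0,\varphi_1,\dots$ be an acceptable enumeration of the partial computable functions and $\Phi_0,\Phi_1,\dots$ an acceptable enumeration of the Turing functionals; $\langle\cdot,\cdot,\cdot\rangle$ is a computable bijective coding of triples. For a set $A$, $A\upharpoonright x=\{n\in A:n\leq x\}$. Define $A^{b_0}=\{\langle e,i,j\rangle: \varphi_i(j)\downarrow\wedge\Phi_e^{A\upharpoonright\varphi_i(j)}(j)\downarrow\}$. $A\leq_{bT}B$ means there are $i,j$ with $\varphi_j$ total and $A(x)=\Phi_i^{B\upharpoonright\varphi_j(x)}(x)$ for all $x$. $\leq_1$ is 1-reducibility. -}

module Defs where

open import Data.Nat using (ℕ; zero; suc; _+_; _<_; _≤ᵇ_)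
open import Data.Bool using (Bool; true; false; if_then_else_)
open import Data.Product using (Σ; _×_; _,_; proj₁; proj₂; ∃)
open import Function.Bundles using (_⇔_)
open import Relation.Binary.PropositionalEquality using (_≡_)

-- Cantor pairing  ⟨x,y⟩ = (x+y)(x+y+1)/2 + y  and its inverse

tri : ℕ → ℕ
tri zero    = 0
tri (suc d) = tri d + suc d

pair : ℕ → ℕ → ℕ
pair x y = tri (x + y) + y

-- inverse of pair, by walking along the Cantor enumeration
unpair : ℕ → ℕ × ℕ
unpair zero = 0 , 0
unpair (suc n) with unpair n
... | zero  , y = suc y , 0
... | suc x , y = x , suc y

triple : ℕ → ℕ → ℕ → ℕ
triple e i j = pair e (pair i j)

-- A standard model of (oracle) computation: unary partial recursive
-- functions on ℕ (via Cantor pairing) with an oracle-query primitive.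

data Code : Set where
  Z S I L R Q : Code                 -- zero, successor, identity, left, right, oracle query
  comp  : Code → Code → Code         -- comp f g = f ∘ g
  pr    : Code → Code → Code         -- x ↦ ⟨f x , g x⟩
  rec   : Code → Code → Code         -- primitive recursion on ⟨x,n⟩
  mu    : Code → Code                -- unbounded minimisation on ⟨x,n⟩

Oracle : Set
Oracle = ℕ → Bool

b2n : Bool → ℕ
b2n true  = 1
b2n false = 0

data Eval : Code → Oracle → ℕ → ℕ → Set where
  evZ : ∀ {O x} → Eval Z O x 0
  evS : ∀ {O x} → Eval S O x (suc x)
  evI : ∀ {O x} → Eval I O x x
  evL : ∀ {O x} → Eval L O x (proj₁ (unpair x))
  evR : ∀ {O x} → Eval R O x (proj₂ (unpair x))
  evQ : ∀ {O x} → Eval Q O x (b2n (O x))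
  evComp : ∀ {f g O x y z} → Eval g O x y → Eval f O y z → Eval (comp f g) O x z
  evPr   : ∀ {f g O x a b} → Eval f O x a → Eval g O x b → Eval (pr f g) O x (pair a b)
  evRec0 : ∀ {f g O x y} → Eval f O x y → Eval (rec f g) O (pair x 0) y
  evRecS : ∀ {f g O x n r y} → Eval (rec f g) O (pair x n) r →
           Eval g O (pair x (pair n r)) y → Eval (rec f g) O (pair x (suc n)) y
  evMu   : ∀ {f O x n} → Eval f O (pair x n) 0 →
           (∀ m → m < n → Σ ℕ λ k → Eval f O (pair x m) (suc k)) →
           Eval (mu f) O x n

encode : Code → ℕ
encode Z = pair 0 0
encode S = pair 1 0
encode I = pair 2 0
encode L = pair 3 0
encode R = pair 4 0
encode Q = pair 5 0
encode (comp f g) = pair 6 (pair (encode f) (encode g))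
encode (pr f g)   = pair 7 (pair (encode f) (encode g))
encode (rec f g)  = pair 8 (pair (encode f) (encode g))
encode (mu f)     = pair 9 (encode f)

emptyOracle : Oracle
emptyOracle _ = false

-- the standard enumeration of partial computable functions:
-- stdφ e x y  means  φ_e(x)↓ = y  (indices not encoding a code are nowhere defined)
stdφ : ℕ → ℕ → ℕ → Set
stdφ e x y = Σ Code λ c → encode c ≡ e × Eval c emptyOracle x y

stdΦ : ℕ → Oracle → ℕ → ℕ → Set
stdΦ e O x y = Σ Code λ c → encode c ≡ e × Eval c O x y

Computable : (ℕ → ℕ) → Set
Computable f = Σ ℕ λ e → ∀ x → stdφ e x (f x)

PNumbering : Set₁
PNumbering = ℕ → ℕ → ℕ → Set

FNumbering : Set₁
FNumbering = ℕ → Oracle → ℕ → ℕ → Set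

AcceptableP : PNumbering → Set
AcceptableP ψ =
  (Σ (ℕ → ℕ) λ f → Computable f × (∀ e x y → ψ e x y ⇔ stdφ (f e) x y)) ×
  (Σ (ℕ → ℕ) λ g → Computable g × (∀ e x y → stdφ e x y ⇔ ψ (g e) x y))

AcceptableF : FNumbering → Set
AcceptableF Ψ =
  (Σ (ℕ → ℕ) λ f → Computable f × (∀ e O x y → Ψ e O x y ⇔ stdΦ (f e) O x y)) ×
  (Σ (ℕ → ℕ) λ g → Computable g × (∀ e O x y → stdΦ e O x y ⇔ Ψ (g e) O x y))

restrict : Oracle → ℕ → Oracle
restrict A n m = if m ≤ᵇ n then A m else false

Total : PNumbering → ℕ → Set
Total ψ j = ∀ x → Σ ℕ λ y → ψ j x y

BoundedTuringRed : PNumbering → FNumbering → Oracle → Oracle → Set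
BoundedTuringRed ψ Ψ A B =
  Σ ℕ λ i → Σ ℕ λ j → Total ψ j ×
    (∀ x → Σ ℕ λ u → ψ j x u × Ψ i (restrict B u) x (b2n (A x)))

boundedJump : PNumbering → FNumbering → Oracle → ℕ → Set
boundedJump ψ Ψ A n =
  Σ ℕ λ e → Σ ℕ λ i → Σ ℕ λ j → n ≡ triple e i j ×
    (Σ ℕ λ u → ψ i j u × Σ ℕ λ y → Ψ e (restrict A u) j y)

OneRed : (ℕ → Set) → (ℕ → Set) → Set
OneRed P P′ = Σ (ℕ → ℕ) λ f → Computable f ×
  (∀ a b → f a ≡ f b → a ≡ b) × (∀ n → P n ⇔ P′ (f n))

module Submission where

-- Let A(x) = Φ_{i₀}^{B ↾ use x}(x) with use = ψ_{j₀} total, and put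
-- useSum u = use 0 + ... + use u.  For n = ⟨e,i,j⟩ the reduction outputs
--   ⟨e′, i′, ⟨j,n⟩⟩,  where  ψ_{i′}(⟨j,n⟩) = useSum (ψ_i(j))  and
--   Ψ_{e′}^{B ↾ useSum u}(⟨j,n⟩) = Ψ_e^{A ↾ u}(j)  for u = ψ_i(j);
-- e′ is obtained from e by replacing every oracle query of Ψ_e by a program
-- that computes (A ↾ u)(y) from B ↾ useSum u (the reduction of A to B, run
-- with the bound use y ≤ useSum u).  The component n makes the map injective.

open import Defs
open import Data.Nat using (ℕ; zero; suc; _+_; _∸_; _⊔_; _≤_; _<_; _≤?_; _≤ᵇ_; pred; s≤s; z≤n)
open import Data.Nat.Properties
open import Data.Bool using (true; false; T)
open import Data.Empty using (⊥-elim)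
open import Data.Unit using (tt)
open import Data.Product using (Σ; _×_; _,_; proj₁; proj₂; uncurry)
open import Data.Sum using (_⊎_; inj₁; inj₂)
open import Function.Bundles using (_⇔_; mk⇔; Equivalence)
open import Function.Properties.Equivalence using () renaming (trans to ⇔-trans)
open import Relation.Binary using (tri<; tri≈; tri>)
open import Relation.Binary.PropositionalEquality
open import Relation.Nullary using (¬_; yes; no)

fst snd : ℕ → ℕ
fst n = proj₁ (unpair n)
snd n = proj₂ (unpair n)

pair-suc-0 : ∀ y → pair (suc y) 0 ≡ suc (pair 0 y)
pair-suc-0 y rewrite +-identityʳ y | +-identityʳ (tri y + suc y) = +-suc (tri y) y

pair-x-suc : ∀ x y → pair x (suc y) ≡ suc (pair (suc x) y)
pair-x-suc x y rewrite +-suc x y = +-suc (tri (suc (x + y))) y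

unpair-suc-0 : ∀ n y → unpair n ≡ (0 , y) → unpair (suc n) ≡ (suc y , 0)
unpair-suc-0 n y eq with unpair n | eq
... | .(0 , y) | refl = refl

unpair-suc-suc : ∀ n x y → unpair n ≡ (suc x , y) → unpair (suc n) ≡ (x , suc y)
unpair-suc-suc n x y eq with unpair n | eq
... | .(suc x , y) | refl = refl

-- unpair inverts pair: induction on the diagonal s = x + y and, inside a
-- diagonal, on y (walking the enumeration backwards).
unpair-pair-diag : ∀ s y x → x + y ≡ s → unpair (pair x y) ≡ (x , y)
unpair-pair-diag zero    zero    zero    _ = refl
unpair-pair-diag zero    (suc y) x       e = ⊥-elim (1+n≢0 (trans (sym (+-suc x y)) e))
unpair-pair-diag (suc s) zero    zero    ()
unpair-pair-diag (suc s) zero    (suc x) e = begin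
  unpair (pair (suc x) 0)  ≡⟨ cong unpair (pair-suc-0 x) ⟩
  unpair (suc (pair 0 x))  ≡⟨ unpair-suc-0 (pair 0 x) x (unpair-pair-diag s x 0 x≡s) ⟩
  (suc x , 0)              ∎
  where
  open ≡-Reasoning
  x≡s : x ≡ s
  x≡s = trans (sym (+-identityʳ x)) (suc-injective e)
unpair-pair-diag (suc s) (suc y) x       e = begin
  unpair (pair x (suc y))      ≡⟨ cong unpair (pair-x-suc x y) ⟩
  unpair (suc (pair (suc x) y)) ≡⟨ unpair-suc-suc (pair (suc x) y) x y (unpair-pair-diag (suc s) y (suc x) (trans (sym (+-suc x y)) e)) ⟩
  (x , suc y)                  ∎
  where open ≡-Reasoning

unpair-pair : ∀ x y → unpair (pair x y) ≡ (x , y)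
unpair-pair x y = unpair-pair-diag (x + y) y x refl

fst-pair : ∀ x y → fst (pair x y) ≡ x
fst-pair x y = cong proj₁ (unpair-pair x y)

snd-pair : ∀ x y → snd (pair x y) ≡ y
snd-pair x y = cong proj₂ (unpair-pair x y)

pair-unpair : ∀ n → pair (fst n) (snd n) ≡ n
pair-unpair zero = refl
pair-unpair (suc n) with unpair n | pair-unpair n
... | zero  , y | previous = trans (pair-suc-0 y) (cong suc previous)
... | suc x , y | previous = trans (pair-x-suc x y) (cong suc previous)

pair-injectiveˡ : ∀ {a b c d} → pair a b ≡ pair c d → a ≡ c
pair-injectiveˡ {a} {b} {c} {d} e = trans (sym (fst-pair a b)) (trans (cong fst e) (fst-pair c d))

pair-injectiveʳ : ∀ {a b c d} → pair a b ≡ pair c d → b ≡ d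
pair-injectiveʳ {a} {b} {c} {d} e = trans (sym (snd-pair a b)) (trans (cong snd e) (snd-pair c d))

-- They make
-- course-of-values recursion along Gödel numbers possible.
n≤tri : ∀ n → n ≤ tri n
n≤tri zero    = z≤n
n≤tri (suc n) = m≤n+m (suc n) (tri n)

fst≤pair : ∀ a b → a ≤ pair a b
fst≤pair a b = ≤-trans (m≤m+n a b) (≤-trans (n≤tri (a + b)) (m≤m+n _ b))

snd≤pair : ∀ a b → b ≤ pair a b
snd≤pair a b = m≤n+m b (tri (a + b))

snd<pair : ∀ a b → 0 < a → b < pair a b
snd<pair (suc a) b _ = ≤-trans (s≤s (m≤n+m b a)) (≤-trans (n≤tri (suc a + b)) (m≤m+n _ b))

triple-components : ∀ n → triple (fst n) (fst (snd n)) (snd (snd n)) ≡ n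
triple-components n = trans (cong (pair (fst n)) (pair-unpair (snd n))) (pair-unpair n)

triple-injective : ∀ {e i j e′ i′ j′} → triple e i j ≡ triple e′ i′ j′ → e ≡ e′ × i ≡ i′ × j ≡ j′
triple-injective {e} {i} {j} {e′} {i′} {j′} eq =
  pair-injectiveˡ {e} {pair i j} {e′} eq , pair-injectiveˡ {i} {j} {i′} inner , pair-injectiveʳ {i} {j} {i′} inner
  where
  inner : pair i j ≡ pair i′ j′
  inner = pair-injectiveʳ {e} {pair i j} {e′} eq

tag : Code → ℕ
tag Z = 0
tag S = 1
tag I = 2
tag L = 3
tag R = 4
tag Q = 5
tag (comp f g) = 6
tag (pr f g)   = 7
tag (rec f g)  = 8
tag (mu f)     = 9

rest : Code → ℕ
rest (comp f g) = pair (encode f) (encode g)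
rest (pr f g)   = pair (encode f) (encode g)
rest (rec f g)  = pair (encode f) (encode g)
rest (mu f)     = encode f
rest _          = 0

encode-tag-rest : ∀ c → encode c ≡ pair (tag c) (rest c)
encode-tag-rest Z = refl
encode-tag-rest S = refl
encode-tag-rest I = refl
encode-tag-rest L = refl
encode-tag-rest R = refl
encode-tag-rest Q = refl
encode-tag-rest (comp f g) = refl
encode-tag-rest (pr f g)   = refl
encode-tag-rest (rec f g)  = refl
encode-tag-rest (mu f)     = refl

tag-of : ∀ c t r → encode c ≡ pair t r → tag c ≡ t
tag-of c t r e = pair-injectiveˡ {tag c} {rest c} {t} {r} (trans (sym (encode-tag-rest c)) e)

rest-of : ∀ c t r → encode c ≡ pair t r → rest c ≡ r
rest-of c t r e = pair-injectiveʳ {tag c} {rest c} {t} {r} (trans (sym (encode-tag-rest c)) e)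

-- Decoding with a bound on the nesting depth; it inverts encode as soon as
-- the bound is large enough, which gives injectivity of the numbering.
decodeNode : (ℕ → Code) → ℕ → ℕ → Code
decodeNode child 0 r = Z
decodeNode child 1 r = S
decodeNode child 2 r = I
decodeNode child 3 r = L
decodeNode child 4 r = R
decodeNode child 5 r = Q
decodeNode child 6 r = comp (child (fst r)) (child (snd r))
decodeNode child 7 r = pr   (child (fst r)) (child (snd r))
decodeNode child 8 r = rec  (child (fst r)) (child (snd r))
decodeNode child 9 r = mu (child r)
decodeNode child _ r = Z

decode : ℕ → ℕ → Code
decode zero    n = Z
decode (suc k) n = decodeNode (decode k) (fst n) (snd n)

depth : Code → ℕ
depth (comp f g) = suc (depth f ⊔ depth g)
depth (pr f g)   = suc (depth f ⊔ depth g)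
depth (rec f g)  = suc (depth f ⊔ depth g)
depth (mu f)     = suc (depth f)
depth _          = 0

decode-pair : ∀ k t r → decode (suc k) (pair t r) ≡ decodeNode (decode k) t r
decode-pair k t r = cong₂ (decodeNode (decode k)) (fst-pair t r) (snd-pair t r)

decode-encode : ∀ c k → depth c ≤ k → decode (suc k) (encode c) ≡ c
decodeNode-correct : ∀ c k → depth c ≤ k → decodeNode (decode k) (tag c) (rest c) ≡ c
decode-left : ∀ f g k → depth f ⊔ depth g ≤ k → decode (suc k) (fst (pair (encode f) (encode g))) ≡ f
decode-right : ∀ f g k → depth f ⊔ depth g ≤ k → decode (suc k) (snd (pair (encode f) (encode g))) ≡ g

decode-encode c k d≤k =
  trans (cong (decode (suc k)) (encode-tag-rest c))
        (trans (decode-pair k (tag c) (rest c)) (decodeNode-correct c k d≤k))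

decodeNode-correct Z k _ = refl
decodeNode-correct S k _ = refl
decodeNode-correct I k _ = refl
decodeNode-correct L k _ = refl
decodeNode-correct R k _ = refl
decodeNode-correct Q k _ = refl
decodeNode-correct (comp f g) (suc k) (s≤s d≤k) = cong₂ comp (decode-left f g k d≤k) (decode-right f g k d≤k)
decodeNode-correct (pr f g)   (suc k) (s≤s d≤k) = cong₂ pr   (decode-left f g k d≤k) (decode-right f g k d≤k)
decodeNode-correct (rec f g)  (suc k) (s≤s d≤k) = cong₂ rec  (decode-left f g k d≤k) (decode-right f g k d≤k)
decodeNode-correct (mu f)     (suc k) (s≤s d≤k) = cong mu (decode-encode f k d≤k)

decode-left f g k d≤k =
  trans (cong (decode (suc k)) (fst-pair (encode f) (encode g))) (decode-encode f k (≤-trans (m≤m⊔n _ _) d≤k))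
decode-right f g k d≤k =
  trans (cong (decode (suc k)) (snd-pair (encode f) (encode g))) (decode-encode g k (≤-trans (m≤n⊔m _ _) d≤k))

encode-injective : ∀ c d → encode c ≡ encode d → c ≡ d
encode-injective c d e = begin
  c                         ≡⟨ sym (decode-encode c k (m≤m⊔n _ _)) ⟩
  decode (suc k) (encode c) ≡⟨ cong (decode (suc k)) e ⟩
  decode (suc k) (encode d) ≡⟨ decode-encode d k (m≤n⊔m _ _) ⟩
  d                         ∎
  where
  open ≡-Reasoning
  k : ℕ
  k = depth c ⊔ depth d

-- Evaluation is deterministic.  The inputs are only required to be equal
-- (not syntactically identical) because recursion matches on pair x n.
eval-deterministic : ∀ {c O x x′ y y′} → Eval c O x y → Eval c O x′ y′ → x ≡ x′ → y ≡ y′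
eval-deterministic evZ evZ e = refl
eval-deterministic evS evS e = cong suc e
eval-deterministic evI evI e = e
eval-deterministic evL evL e = cong fst e
eval-deterministic evR evR e = cong snd e
eval-deterministic {O = O} evQ evQ e = cong (λ z → b2n (O z)) e
eval-deterministic (evComp d₁ d₂) (evComp d₁′ d₂′) e =
  eval-deterministic d₂ d₂′ (eval-deterministic d₁ d₁′ e)
eval-deterministic (evPr d₁ d₂) (evPr d₁′ d₂′) e =
  cong₂ pair (eval-deterministic d₁ d₁′ e) (eval-deterministic d₂ d₂′ e)
eval-deterministic (evRec0 {x = x} d) (evRec0 {x = x′} d′) e =
  eval-deterministic d d′ (pair-injectiveˡ {x} {0} {x′} {0} e)
eval-deterministic (evRec0 {x = x} d) (evRecS {x = x′} {n = n} _ _) e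
  with () ← pair-injectiveʳ {x} {0} {x′} {suc n} e
eval-deterministic (evRecS {x = x} {n = n} _ _) (evRec0 {x = x′} _) e
  with () ← pair-injectiveʳ {x} {suc n} {x′} {0} e
eval-deterministic (evRecS {x = x} {n = n} d₁ d₂) (evRecS {x = x′} {n = n′} d₁′ d₂′) e =
  eval-deterministic d₂ d₂′ (cong₂ pair x≡x′ (cong₂ pair n≡n′ (eval-deterministic d₁ d₁′ (cong₂ pair x≡x′ n≡n′))))
  where
  x≡x′ : x ≡ x′
  x≡x′ = pair-injectiveˡ {x} {suc n} {x′} {suc n′} e
  n≡n′ : n ≡ n′
  n≡n′ = suc-injective (pair-injectiveʳ {x} {suc n} {x′} {suc n′} e)
eval-deterministic (evMu {n = n} d below) (evMu {n = n′} d′ below′) e with <-cmp n n′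
... | tri≈ _ n≡n′ _ = n≡n′
... | tri< n<n′ _ _ with () ← eval-deterministic d (proj₂ (below′ n n<n′)) (cong₂ pair e refl)
... | tri> _ _ n′<n with () ← eval-deterministic d′ (proj₂ (below n′ n′<n)) (cong₂ pair (sym e) refl)

record Fn : Set where
  constructor mkFn
  field
    code     : Code
    fun      : ℕ → ℕ
    computes : ∀ {O} x → Eval code O x (fun x)
open Fn public

evL-pair : ∀ {O} a b → Eval L O (pair a b) a
evL-pair {O} a b = subst (Eval L O (pair a b)) (fst-pair a b) evL

evR-pair : ∀ {O} a b → Eval R O (pair a b) b
evR-pair {O} a b = subst (Eval R O (pair a b)) (snd-pair a b) evR

eval-comp⁻¹ : ∀ {f g O x z} → Eval (comp f g) O x z → Σ ℕ λ m → Eval g O x m × Eval f O m z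
eval-comp⁻¹ (evComp d₁ d₂) = _ , d₁ , d₂

zeroF sucF idF fstF sndF : Fn
zeroF = mkFn Z (λ _ → 0) (λ x → evZ)
sucF  = mkFn S suc       (λ x → evS)
idF   = mkFn I (λ x → x) (λ x → evI)
fstF  = mkFn L fst       (λ x → evL)
sndF  = mkFn R snd       (λ x → evR)

infixr 9 _∘F_
_∘F_ : Fn → Fn → Fn
f ∘F g = mkFn (comp (code f) (code g)) (λ x → fun f (fun g x)) (λ x → evComp (computes g x) (computes f _))

pairF : Fn → Fn → Fn
pairF f g = mkFn (pr (code f) (code g)) (λ x → pair (fun f x) (fun g x)) (λ x → evPr (computes f x) (computes g x))

extF : (F : Fn) (h : ℕ → ℕ) → (∀ x → fun F x ≡ h x) → Fn
extF F h e = mkFn (code F) h (λ {O} x → subst (Eval (code F) O x) (e x) (computes F x))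

constCode : ℕ → Code
constCode zero    = Z
constCode (suc k) = comp S (constCode k)

constCode-eval : ∀ {O} k x → Eval (constCode k) O x k
constCode-eval zero    x = evZ
constCode-eval (suc k) x = evComp (constCode-eval k x) evS

constF : ℕ → Fn
constF k = mkFn (constCode k) (λ _ → k) (constCode-eval k)

primRec : (ℕ → ℕ) → (ℕ → ℕ) → ℕ → ℕ → ℕ
primRec f g x zero    = f x
primRec f g x (suc n) = g (pair x (pair n (primRec f g x n)))

rec-eval : ∀ {O} (f g : Fn) x n → Eval (rec (code f) (code g)) O (pair x n) (primRec (fun f) (fun g) x n)
rec-eval f g x zero    = evRec0 {x = x} (computes f x)
rec-eval f g x (suc n) = evRecS {x = x} {n = n} (rec-eval f g x n) (computes g _)

recF : Fn → Fn → Fn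
recF f g = mkFn (rec (code f) (code g)) (λ p → primRec (fun f) (fun g) (fst p) (snd p))
  (λ {O} p → subst (λ q → Eval (rec (code f) (code g)) O q (primRec (fun f) (fun g) (fst p) (snd p)))
                   (pair-unpair p) (rec-eval f g (fst p) (snd p)))

-- The recursion step g of primRec sees pair x (pair n r): the counter n
-- and the previous value r are its second and third components.
third : ∀ x n r → snd (snd (pair x (pair n r))) ≡ r
third x n r = trans (cong snd (snd-pair x (pair n r))) (snd-pair n r)

second : ∀ x n r → fst (snd (pair x (pair n r))) ≡ n
second x n r = trans (cong fst (snd-pair x (pair n r))) (fst-pair n r)

-- Lists are coded as iterated pairs  pair head tail ; drop t m removes the
-- first m entries.
drop : ℕ → ℕ → ℕ
drop t zero    = t
drop t (suc m) = snd (drop t m)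

ifz : ℕ → ℕ → ℕ → ℕ
ifz zero    a b = a
ifz (suc _) a b = b

plusF : Fn
plusF = extF (recF idF (sucF ∘F sndF ∘F sndF)) (λ p → fst p + snd p) (λ p → correct (fst p) (snd p))
  where
  correct : ∀ a n → primRec (λ x → x) (λ x → suc (snd (snd x))) a n ≡ a + n
  correct a zero    = sym (+-identityʳ a)
  correct a (suc n) = trans (cong suc (trans (third a n _) (correct a n))) (sym (+-suc a n))

predF : Fn
predF = extF (recF zeroF (fstF ∘F sndF) ∘F pairF zeroF idF) pred
  (λ x → trans (cong₂ (primRec (λ _ → 0) (λ x → fst (snd x))) (fst-pair 0 x) (snd-pair 0 x)) (correct x))
  where
  correct : ∀ n → primRec (λ _ → 0) (λ x → fst (snd x)) 0 n ≡ pred n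
  correct zero    = refl
  correct (suc n) = trans (cong fst (snd-pair 0 (pair n _))) (fst-pair n _)

monusF : Fn
monusF = extF (recF idF (predF ∘F sndF ∘F sndF)) (λ p → fst p ∸ snd p) (λ p → correct (fst p) (snd p))
  where
  correct : ∀ a n → primRec (λ x → x) (λ x → pred (snd (snd x))) a n ≡ a ∸ n
  correct a zero    = refl
  correct a (suc n) = trans (cong pred (trans (third a n _) (correct a n))) (pred[m∸n]≡m∸[1+n] a n)

dropF : Fn
dropF = extF (recF idF (sndF ∘F sndF ∘F sndF)) (λ p → drop (fst p) (snd p)) (λ p → correct (fst p) (snd p))
  where
  correct : ∀ a n → primRec (λ x → x) (λ x → snd (snd (snd x))) a n ≡ drop a n
  correct a zero    = refl
  correct a (suc n) = cong snd (trans (third a n _) (correct a n))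

ifzF : Fn
ifzF = extF (recF fstF (sndF ∘F fstF)) (λ p → ifz (snd p) (fst (fst p)) (snd (fst p))) (λ p → correct (fst p) (snd p))
  where
  correct : ∀ q n → primRec fst (λ x → snd (fst x)) q n ≡ ifz n (fst q) (snd q)
  correct q zero    = refl
  correct q (suc n) = cong snd (fst-pair q _)

binaryF : (op : ℕ → ℕ → ℕ) (P : Fn) → (∀ p → fun P p ≡ op (fst p) (snd p)) → Fn → Fn → Fn
binaryF op P P-op F G = extF (P ∘F pairF F G) (λ x → op (fun F x) (fun G x))
  (λ x → trans (P-op _) (cong₂ op (fst-pair (fun F x) (fun G x)) (snd-pair (fun F x) (fun G x))))

_+F_ _∸F_ dropF₂ : Fn → Fn → Fn
_+F_   = binaryF _+_  plusF  (λ p → refl)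
_∸F_   = binaryF _∸_  monusF (λ p → refl)
dropF₂ = binaryF drop dropF  (λ p → refl)

ifzF₃ : Fn → Fn → Fn → Fn
ifzF₃ A B C = extF (ifzF ∘F pairF (pairF A B) C) (λ x → ifz (fun C x) (fun A x) (fun B x))
  (λ x → correct (fun A x) (fun B x) (fun C x))
  where
  correct : ∀ a b c → ifz (snd (pair (pair a b) c)) (fst (fst (pair (pair a b) c))) (snd (fst (pair (pair a b) c))) ≡ ifz c a b
  correct a b c rewrite snd-pair (pair a b) c | fst-pair (pair a b) c | fst-pair a b | snd-pair a b = refl

-- Comparison: F ≤F G returns 1 if F x ≤ G x and 0 otherwise.
_≤F_ : Fn → Fn → Fn
F ≤F G = constF 1 ∸F (F ∸F G)

constCode#F : Fn
constCode#F = extF (recF zeroF (pairF (constF 6) (pairF (constF (encode S)) (sndF ∘F sndF))) ∘F pairF zeroF idF)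
  (λ j → encode (constCode j)) (λ j → trans (cong₂ (primRec (λ _ → 0) step) (fst-pair 0 j) (snd-pair 0 j)) (correct j))
  where
  step : ℕ → ℕ
  step q = pair 6 (pair (encode S) (snd (snd q)))
  correct : ∀ k → primRec (λ _ → 0) step 0 k ≡ encode (constCode k)
  correct zero    = refl
  correct (suc k) = cong (λ v → pair 6 (pair (encode S) v)) (trans (third 0 k _) (correct k))

restrict-≤ : ∀ X {b z} → z ≤ b → restrict X b z ≡ X z
restrict-≤ X {b} {z} z≤b with z ≤ᵇ b | ≤⇒≤ᵇ z≤b
... | true | _ = refl

restrict-> : ∀ X {b z} → ¬ z ≤ b → restrict X b z ≡ false
restrict-> X {b} {z} z≰b with z ≤ᵇ b in eq
... | false = refl
... | true  = ⊥-elim (z≰b (≤ᵇ⇒≤ z b (subst T (sym eq) tt)))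

1∸positive : ∀ {k} → 0 < k → 1 ∸ k ≡ 0
1∸positive {suc k} _ = 0∸n≡0 k

-- guarded F C computes F where C returns 1 and 0 where C returns 0.
guarded : Code → Code → Code
guarded F C = comp (rec Z (comp F L)) (pr I C)

guarded-restrict : ∀ {F C O p} X b z → Eval C O p (1 ∸ (z ∸ b)) → (z ≤ b → Eval F O p (b2n (X z))) →
                   Eval (guarded F C) O p (b2n (restrict X b z))
guarded-restrict {F} {C} {O} {p} X b z dC dF with z ≤? b
... | yes z≤b = subst (Eval (guarded F C) O p) (cong b2n (sym (restrict-≤ X z≤b)))
  (evComp (evPr evI (subst (Eval C O p) (cong (1 ∸_) (m≤n⇒m∸n≡0 z≤b)) dC))
          (evRecS {x = p} {n = 0} {r = 0} (evRec0 {x = p} evZ) (evComp (evL-pair p (pair 0 0)) (dF z≤b))))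
... | no z≰b = subst (Eval (guarded F C) O p) (cong b2n (sym (restrict-> X z≰b)))
  (evComp (evPr evI (subst (Eval C O p) (1∸positive (m<n⇒0<n∸m (≰⇒> z≰b))) dC)) (evRec0 {x = p} evZ))

-- Sealing a code hides it, and thereby its (large) Gödel number, from the
-- type checker; this keeps unification between index expressions cheap.
opaque
  seal : Code → Code
  seal c = c

  unseal : ∀ c → seal c ≡ c
  unseal c = refl

seal-eval : ∀ {c O x y} → Eval c O x y → Eval (seal c) O x y
seal-eval {c} {O} {x} {y} = subst (λ d → Eval d O x y) (sym (unseal c))

sealF : Fn → Fn
sealF F = mkFn (seal (code F)) (fun F) (λ x → seal-eval (computes F x))

replaceQ : Code → Code → Code
replaceQ s Z = Z
replaceQ s S = S
replaceQ s I = I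
replaceQ s L = L
replaceQ s R = R
replaceQ s Q = s
replaceQ s (comp f g) = comp (replaceQ s f) (replaceQ s g)
replaceQ s (pr f g)   = pr (replaceQ s f) (replaceQ s g)
replaceQ s (rec f g)  = rec (replaceQ s f) (replaceQ s g)
replaceQ s (mu f)     = mu (replaceQ s f)

module _ {s : Code} {O O′ : Oracle} (s-computes : ∀ y → Eval s O y (b2n (O′ y))) where

  replaceQ-sound : ∀ {c x z} → Eval c O′ x z → Eval (replaceQ s c) O x z
  replaceQ-sound evZ = evZ
  replaceQ-sound evS = evS
  replaceQ-sound evI = evI
  replaceQ-sound evL = evL
  replaceQ-sound evR = evR
  replaceQ-sound {x = x} evQ = s-computes x
  replaceQ-sound (evComp d₁ d₂) = evComp (replaceQ-sound d₁) (replaceQ-sound d₂)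
  replaceQ-sound (evPr d₁ d₂)   = evPr (replaceQ-sound d₁) (replaceQ-sound d₂)
  replaceQ-sound (evRec0 {x = a} d) = evRec0 {x = a} (replaceQ-sound d)
  replaceQ-sound (evRecS {x = a} {n = n} d₁ d₂) = evRecS {x = a} {n = n} (replaceQ-sound d₁) (replaceQ-sound d₂)
  replaceQ-sound (evMu {x = a} {n = n} d below) =
    evMu {x = a} {n = n} (replaceQ-sound d) (λ m m<n → proj₁ (below m m<n) , replaceQ-sound (proj₂ (below m m<n)))

  replaceQ-complete : ∀ c {x z} → Eval (replaceQ s c) O x z → Eval c O′ x z
  replaceQ-complete Z evZ = evZ
  replaceQ-complete S evS = evS
  replaceQ-complete I evI = evI
  replaceQ-complete L evL = evL
  replaceQ-complete R evR = evR
  replaceQ-complete Q {x} d = subst (Eval Q O′ x) (eval-deterministic (s-computes x) d refl) evQ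
  replaceQ-complete (comp f g) (evComp d₁ d₂) = evComp (replaceQ-complete g d₁) (replaceQ-complete f d₂)
  replaceQ-complete (pr f g) (evPr d₁ d₂) = evPr (replaceQ-complete f d₁) (replaceQ-complete g d₂)
  replaceQ-complete (rec f g) (evRec0 {x = a} d) = evRec0 {x = a} (replaceQ-complete f d)
  replaceQ-complete (rec f g) (evRecS {x = a} {n = n} d₁ d₂) =
    evRecS {x = a} {n = n} (replaceQ-complete (rec f g) d₁) (replaceQ-complete g d₂)
  replaceQ-complete (mu f) (evMu {x = a} {n = n} d below) =
    evMu {x = a} {n = n} (replaceQ-complete f d) (λ m m<n → proj₁ (below m m<n) , replaceQ-complete f (proj₂ (below m m<n)))

-- A computation relative to the empty oracle only ever receives 0 from its
-- queries; answering them by Z makes it independent of the oracle.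
emptyOracle-free : ∀ {c O x y} → Eval c emptyOracle x y → Eval (replaceQ Z c) O x y
emptyOracle-free = replaceQ-sound (λ _ → evZ)

-- Codes sharing a Gödel number are equal, so a family of witnesses with a
-- common index is a single code working for every argument.
common-code : ∀ {e} (P : Code → ℕ → Set) → (∀ x → Σ Code λ c → encode c ≡ e × P c x) →
              Σ Code λ c → ∀ x → P c x
common-code P h = proj₁ (h 0) , λ x →
  subst (λ c → P c x) (encode-injective _ _ (trans (proj₁ (proj₂ (h x))) (sym (proj₁ (proj₂ (h 0))))))
        (proj₂ (proj₂ (h x)))

indexF : ∀ {e} (f : ℕ → ℕ) → (∀ x → stdφ e x (f x)) → Fn
indexF f h = mkFn (replaceQ Z c) f (λ x → emptyOracle-free (c-computes x))
  where
  c : Code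
  c = proj₁ (common-code (λ c x → Eval c emptyOracle x (f x)) h)
  c-computes : ∀ x → Eval c emptyOracle x (f x)
  c-computes = proj₂ (common-code (λ c x → Eval c emptyOracle x (f x)) h)

computableF : ∀ {f} → Computable f → Fn
computableF {f} (e , h) = indexF f h

assocʳ assocˡ : Code
assocʳ = pr (comp L L) (pr (comp R L) R)
assocˡ = pr (pr L (comp L R)) (comp R R)

assocʳ-eval : ∀ {O} x a b → Eval assocʳ O (pair (pair x a) b) (pair x (pair a b))
assocʳ-eval x a b =
  evPr (evComp (evL-pair (pair x a) b) (evL-pair x a))
       (evPr (evComp (evL-pair (pair x a) b) (evR-pair x a)) (evR-pair (pair x a) b))

assocˡ-eval : ∀ {O} x a n → Eval assocˡ O (pair x (pair a n)) (pair (pair x a) n)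
assocˡ-eval x a n =
  evPr (evPr (evL-pair x (pair a n)) (evComp (evR-pair x (pair a n)) (evL-pair a n)))
       (evComp (evR-pair x (pair a n)) (evR-pair a n))

-- withParam P c runs on pair x v like c on v, except that a query z is
-- answered by P on pair x z: the parameter x is threaded through c.
withParam : Code → Code → Code
withParam P Z = comp Z R
withParam P S = comp S R
withParam P I = comp I R
withParam P L = comp L R
withParam P R = comp R R
withParam P Q = P
withParam P (comp f g) = comp (withParam P f) (pr L (withParam P g))
withParam P (pr f g)   = pr (withParam P f) (withParam P g)
withParam P (rec f g)  = comp (rec (withParam P f) (comp (withParam P g) assocʳ)) assocˡ
withParam P (mu f)     = mu (comp (withParam P f) assocʳ)

module _ {P : Code} {O O′ : Oracle} {x : ℕ} (P-computes : ∀ z → Eval P O (pair x z) (b2n (O′ z))) where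

  withParam-sound : ∀ {c v w} → Eval c O′ v w → Eval (withParam P c) O (pair x v) w
  withParam-rec : ∀ {f g p w} → Eval (rec f g) O′ p w → ∀ a n → p ≡ pair a n →
                  Eval (rec (withParam P f) (comp (withParam P g) assocʳ)) O (pair (pair x a) n) w

  withParam-sound {v = v} evZ = evComp (evR-pair x v) evZ
  withParam-sound {v = v} evS = evComp (evR-pair x v) evS
  withParam-sound {v = v} evI = evComp (evR-pair x v) evI
  withParam-sound {v = v} evL = evComp (evR-pair x v) evL
  withParam-sound {v = v} evR = evComp (evR-pair x v) evR
  withParam-sound {v = v} evQ = P-computes v
  withParam-sound {v = v} (evComp d₁ d₂) = evComp (evPr (evL-pair x v) (withParam-sound d₁)) (withParam-sound d₂)
  withParam-sound (evPr d₁ d₂) = evPr (withParam-sound d₁) (withParam-sound d₂)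
  withParam-sound d@(evRec0 {x = a} _)           = evComp (assocˡ-eval x a 0) (withParam-rec d a 0 refl)
  withParam-sound d@(evRecS {x = a} {n = n} _ _) = evComp (assocˡ-eval x a (suc n)) (withParam-rec d a (suc n) refl)
  withParam-sound (evMu {x = v} {n = n} d below) =
    evMu {x = pair x v} {n = n} (evComp (assocʳ-eval x v n) (withParam-sound d))
      (λ m m<n → proj₁ (below m m<n) , evComp (assocʳ-eval x v m) (withParam-sound (proj₂ (below m m<n))))

  withParam-rec (evRec0 {x = a′} d) a n e
    with refl ← pair-injectiveˡ {a′} {0} {a} {n} e | refl ← pair-injectiveʳ {a′} {0} {a} {n} e
    = evRec0 {x = pair x a} (withParam-sound d)
  withParam-rec (evRecS {x = a′} {n = n′} {r = r} d₁ d₂) a n e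
    with refl ← pair-injectiveˡ {a′} {suc n′} {a} {n} e | refl ← pair-injectiveʳ {a′} {suc n′} {a} {n} e
    = evRecS {x = pair x a′} {n = n′} (withParam-rec d₁ a′ n′ refl)
             (evComp (assocʳ-eval x a′ (pair n′ r)) (withParam-sound d₂))

-- It is computed by course-of-values recursion: the value at n is obtained
-- from the table  pair (T (n-1)) (pair (T (n-2)) ... 0)  of all earlier values,
-- since the numbers of the subcodes of a code are smaller than its number.

lookup : ℕ → ℕ → ℕ → ℕ
lookup n t k = fst (drop t (n ∸ suc k))

-- The value at n = pair tag r from the table t, s being the number of the
-- code substituted for Q:
--   tag = 5, r = 0 (the code Q)  ↦ s
--   tag ∈ {6,7,8}, r = pair a b  ↦ pair tag (pair (T a) (T b))
--   tag = 9                      ↦ pair 9 (T r)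
--   otherwise                    ↦ n.
replaceStep : ℕ → ℕ → ℕ → ℕ
replaceStep s n t =
  ifz (5 ∸ fst n)
    (ifz (fst n ∸ 5)
       (ifz (snd n) s n)
       (ifz ((fst n ∸ 5) ∸ 3)
          (pair (fst n) (pair (lookup n t (fst (snd n))) (lookup n t (snd (snd n)))))
          (ifz ((fst n ∸ 5) ∸ 4) (pair (fst n) (lookup n t (snd n))) n)))
    n

replaceStepF : Fn
replaceStepF = extF
  (ifzF₃ (ifzF₃ (ifzF₃ sF nF rF)
                (ifzF₃ (pairF tagF (pairF (lookupF (fstF ∘F rF)) (lookupF (sndF ∘F rF))))
                       (ifzF₃ (pairF tagF (lookupF rF)) nF (tag-5F ∸F constF 4))
                       (tag-5F ∸F constF 3))
                tag-5F)
         nF (constF 5 ∸F tagF))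
  (λ p → replaceStep (fst p) (fst (snd p)) (snd (snd p))) (λ p → refl)
  where
  sF nF tF tagF rF tag-5F : Fn
  sF = fstF
  nF = fstF ∘F sndF
  tF = sndF ∘F sndF
  tagF = fstF ∘F nF
  rF = sndF ∘F nF
  tag-5F = tagF ∸F constF 5
  lookupF : Fn → Fn
  lookupF K = fstF ∘F dropF₂ tF (nF ∸F (sucF ∘F K))

table : ℕ → ℕ → ℕ
table s n = primRec (λ _ → 0) (λ p → pair (replaceStep (fst p) (fst (snd p)) (snd (snd p))) (snd (snd p))) s n

-- The Gödel-number version of replaceQ.  It is opaque so that type checking
-- never unfolds the table.
opaque
  replaceQ# : ℕ → ℕ → ℕ
  replaceQ# s n = replaceStep s n (table s n)

  replaceQ#-step : ∀ s n → replaceQ# s n ≡ replaceStep s n (table s n)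
  replaceQ#-step s n = refl

replaceQ#F : Fn
replaceQ#F = extF (replaceStepF ∘F pairF fstF (pairF sndF tableF)) (λ q → replaceQ# (fst q) (snd q))
  (λ q → correct (fst q) (snd q))
  where
  tableF : Fn
  tableF = recF zeroF (pairF replaceStepF (sndF ∘F sndF))
  correct : ∀ a b → replaceStep (fst (pair a (pair b (table a b)))) (fst (snd (pair a (pair b (table a b)))))
                                (snd (snd (pair a (pair b (table a b))))) ≡ replaceQ# a b
  correct a b rewrite fst-pair a (pair b (table a b)) | snd-pair a (pair b (table a b))
                    | fst-pair b (table a b) | snd-pair b (table a b) = sym (replaceQ#-step a b)

replaceQ#₂ : Fn → Fn → Fn
replaceQ#₂ = binaryF replaceQ# replaceQ#F (λ p → refl)

table-suc : ∀ s n → table s (suc n) ≡ pair (replaceQ# s n) (table s n)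
table-suc s n rewrite fst-pair s (pair n (table s n)) | snd-pair s (pair n (table s n))
                    | fst-pair n (table s n) | snd-pair n (table s n) =
  cong (λ v → pair v (table s n)) (sym (replaceQ#-step s n))

drop-table : ∀ s n m → m ≤ n → drop (table s n) m ≡ table s (n ∸ m)
drop-table s n zero    _   = refl
drop-table s n (suc m) m<n = begin
  snd (drop (table s n) m)                                    ≡⟨ cong snd (drop-table s n m (<⇒≤ m<n)) ⟩
  snd (table s (n ∸ m))                                       ≡⟨ cong (λ k → snd (table s k)) (+-∸-assoc 1 m<n) ⟩
  snd (table s (suc (n ∸ suc m)))                             ≡⟨ cong snd (table-suc s (n ∸ suc m)) ⟩
  snd (pair (replaceQ# s (n ∸ suc m)) (table s (n ∸ suc m)))  ≡⟨ snd-pair (replaceQ# s (n ∸ suc m)) _ ⟩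
  table s (n ∸ suc m)                                         ∎
  where open ≡-Reasoning

lookup-table : ∀ s n k → k < n → lookup n (table s n) k ≡ replaceQ# s k
lookup-table s n k k<n = begin
  fst (drop (table s n) (n ∸ suc k))   ≡⟨ cong fst (drop-table s n (n ∸ suc k) (m∸n≤m n (suc k))) ⟩
  fst (table s (n ∸ (n ∸ suc k)))      ≡⟨ cong (λ m → fst (table s m)) (m∸[m∸n]≡n k<n) ⟩
  fst (table s (suc k))                ≡⟨ cong fst (table-suc s k) ⟩
  fst (pair (replaceQ# s k) (table s k)) ≡⟨ fst-pair _ (table s k) ⟩
  replaceQ# s k                        ∎
  where open ≡-Reasoning

lookup-component : ∀ s tag r k → 0 < tag → k ≤ r → lookup (pair tag r) (table s (pair tag r)) k ≡ replaceQ# s k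
lookup-component s tag r k 0<tag k≤r = lookup-table s (pair tag r) k (≤-<-trans k≤r (snd<pair tag r 0<tag))

replaceStepAt : ℕ → ℕ → ℕ → ℕ → ℕ
replaceStepAt s tag r n =
  ifz (5 ∸ tag)
    (ifz (tag ∸ 5)
       (ifz r s n)
       (ifz ((tag ∸ 5) ∸ 3)
          (pair tag (pair (lookup n (table s n) (fst r)) (lookup n (table s n) (snd r))))
          (ifz ((tag ∸ 5) ∸ 4) (pair tag (lookup n (table s n) r)) n)))
    n

replaceQ#-pair : ∀ s tag r → replaceQ# s (pair tag r) ≡ replaceStepAt s tag r (pair tag r)
replaceQ#-pair s tag r rewrite replaceQ#-step s (pair tag r) | fst-pair tag r | snd-pair tag r = refl

data BinaryTag : ℕ → Set where
  tag6 : BinaryTag 6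
  tag7 : BinaryTag 7
  tag8 : BinaryTag 8

children : ∀ s t a b → 0 < t →
  pair t (pair (lookup (pair t (pair a b)) (table s (pair t (pair a b))) (fst (pair a b)))
               (lookup (pair t (pair a b)) (table s (pair t (pair a b))) (snd (pair a b))))
  ≡ pair t (pair (replaceQ# s a) (replaceQ# s b))
children s t a b 0<t rewrite fst-pair a b | snd-pair a b =
  cong₂ (λ u v → pair t (pair u v)) (lookup-component s t (pair a b) a 0<t (fst≤pair a b))
                                    (lookup-component s t (pair a b) b 0<t (snd≤pair a b))

replaceQ#-binary : ∀ s {t} → BinaryTag t → ∀ a b →
                   replaceQ# s (pair t (pair a b)) ≡ pair t (pair (replaceQ# s a) (replaceQ# s b))
replaceQ#-binary s tag6 a b = trans (replaceQ#-pair s 6 (pair a b)) (children s 6 a b (s≤s z≤n))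
replaceQ#-binary s tag7 a b = trans (replaceQ#-pair s 7 (pair a b)) (children s 7 a b (s≤s z≤n))
replaceQ#-binary s tag8 a b = trans (replaceQ#-pair s 8 (pair a b)) (children s 8 a b (s≤s z≤n))

replaceQ#-mu : ∀ s r → replaceQ# s (pair 9 r) ≡ pair 9 (replaceQ# s r)
replaceQ#-mu s r = trans (replaceQ#-pair s 9 r) (cong (pair 9) (lookup-component s 9 r r (s≤s z≤n) ≤-refl))

replaceQ#-correct : ∀ s c → replaceQ# (encode s) (encode c) ≡ encode (replaceQ s c)
replaceQ#-correct s Z = replaceQ#-pair (encode s) 0 0
replaceQ#-correct s S = replaceQ#-pair (encode s) 1 0
replaceQ#-correct s I = replaceQ#-pair (encode s) 2 0
replaceQ#-correct s L = replaceQ#-pair (encode s) 3 0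
replaceQ#-correct s R = replaceQ#-pair (encode s) 4 0
replaceQ#-correct s Q = replaceQ#-pair (encode s) 5 0
replaceQ#-correct s (comp f g) = trans (replaceQ#-binary (encode s) tag6 (encode f) (encode g))
  (cong₂ (λ u v → pair 6 (pair u v)) (replaceQ#-correct s f) (replaceQ#-correct s g))
replaceQ#-correct s (pr f g) = trans (replaceQ#-binary (encode s) tag7 (encode f) (encode g))
  (cong₂ (λ u v → pair 7 (pair u v)) (replaceQ#-correct s f) (replaceQ#-correct s g))
replaceQ#-correct s (rec f g) = trans (replaceQ#-binary (encode s) tag8 (encode f) (encode g))
  (cong₂ (λ u v → pair 8 (pair u v)) (replaceQ#-correct s f) (replaceQ#-correct s g))
replaceQ#-correct s (mu f) = trans (replaceQ#-mu (encode s) (encode f)) (cong (pair 9) (replaceQ#-correct s f))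

-- Backward correctness: whatever code replaceQ# produces from a number n is
-- replaceQ s c for a code c numbered n.  The argument classifies numbers by
-- their tag.

data IsAtom : Code → Set where
  Z-atom : IsAtom Z
  S-atom : IsAtom S
  I-atom : IsAtom I
  L-atom : IsAtom L
  R-atom : IsAtom R

replaceQ-atom : ∀ {s c} → IsAtom c → replaceQ s c ≡ c
replaceQ-atom Z-atom = refl
replaceQ-atom S-atom = refl
replaceQ-atom I-atom = refl
replaceQ-atom L-atom = refl
replaceQ-atom R-atom = refl

data NonAtomic : ℕ → ℕ → Set where
  query-number  : NonAtomic 5 0
  binary-number : ∀ {t r} → BinaryTag t → NonAtomic t r
  mu-number     : ∀ {r} → NonAtomic 9 r

atom-or-nonAtomic : ∀ c → IsAtom c ⊎ NonAtomic (tag c) (rest c)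
atom-or-nonAtomic Z = inj₁ Z-atom
atom-or-nonAtomic S = inj₁ S-atom
atom-or-nonAtomic I = inj₁ I-atom
atom-or-nonAtomic L = inj₁ L-atom
atom-or-nonAtomic R = inj₁ R-atom
atom-or-nonAtomic Q = inj₂ query-number
atom-or-nonAtomic (comp f g) = inj₂ (binary-number tag6)
atom-or-nonAtomic (pr f g)   = inj₂ (binary-number tag7)
atom-or-nonAtomic (rec f g)  = inj₂ (binary-number tag8)
atom-or-nonAtomic (mu f)     = inj₂ mu-number

only-atoms : ∀ t r → ¬ NonAtomic t r → ∀ c → encode c ≡ pair t r → IsAtom c
only-atoms t r ¬na c e with atom-or-nonAtomic c
... | inj₁ atom = atom
... | inj₂ na   = ⊥-elim (¬na (subst₂ NonAtomic (tag-of c t r e) (rest-of c t r e) na))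

data Shape (n : ℕ) : Set where
  query-shape  : n ≡ pair 5 0 → Shape n
  binary-shape : ∀ {t} → BinaryTag t → ∀ a b → n ≡ pair t (pair a b) → Shape n
  mu-shape     : ∀ r → n ≡ pair 9 r → Shape n
  other-shape  : (∀ s → replaceQ# s n ≡ n) → (∀ c → encode c ≡ n → IsAtom c) → Shape n

shape-pair : ∀ t r → Shape (pair t r)
shape-pair 0 r = other-shape (λ s → replaceQ#-pair s 0 r) (only-atoms 0 r λ { (binary-number ()) })
shape-pair 1 r = other-shape (λ s → replaceQ#-pair s 1 r) (only-atoms 1 r λ { (binary-number ()) })
shape-pair 2 r = other-shape (λ s → replaceQ#-pair s 2 r) (only-atoms 2 r λ { (binary-number ()) })
shape-pair 3 r = other-shape (λ s → replaceQ#-pair s 3 r) (only-atoms 3 r λ { (binary-number ()) })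
shape-pair 4 r = other-shape (λ s → replaceQ#-pair s 4 r) (only-atoms 4 r λ { (binary-number ()) })
shape-pair 5 zero    = query-shape refl
shape-pair 5 (suc r) = other-shape (λ s → replaceQ#-pair s 5 (suc r)) (only-atoms 5 (suc r) λ { (binary-number ()) })
shape-pair 6 r = binary-shape tag6 (fst r) (snd r) (cong (pair 6) (sym (pair-unpair r)))
shape-pair 7 r = binary-shape tag7 (fst r) (snd r) (cong (pair 7) (sym (pair-unpair r)))
shape-pair 8 r = binary-shape tag8 (fst r) (snd r) (cong (pair 8) (sym (pair-unpair r)))
shape-pair 9 r = mu-shape r refl
shape-pair (suc (suc (suc (suc (suc (suc (suc (suc (suc (suc m)))))))))) r =
  other-shape (λ s → replaceQ#-pair s (10 + m) r) (only-atoms (10 + m) r λ { (binary-number ()) })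

shape : ∀ n → Shape n
shape n = subst Shape (pair-unpair n) (shape-pair (fst n) (snd n))

data Node₂ : ℕ → Code → Set where
  comp-node : ∀ f g → Node₂ 6 (comp f g)
  pr-node   : ∀ f g → Node₂ 7 (pr f g)
  rec-node  : ∀ f g → Node₂ 8 (rec f g)

node₂ : ∀ c {t} → tag c ≡ t → BinaryTag t → Node₂ t c
node₂ (comp f g) refl tag6 = comp-node f g
node₂ (pr f g)   refl tag7 = pr-node f g
node₂ (rec f g)  refl tag8 = rec-node f g
node₂ Z      refl ()
node₂ S      refl ()
node₂ I      refl ()
node₂ L      refl ()
node₂ R      refl ()
node₂ Q      refl ()
node₂ (mu f) refl ()

data Node₁ : Code → Set where
  mu-node : ∀ f → Node₁ (mu f)

node₁ : ∀ c → tag c ≡ 9 → Node₁ c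
node₁ (mu f) refl = mu-node f
node₁ Z          ()
node₁ S          ()
node₁ I          ()
node₁ L          ()
node₁ R          ()
node₁ Q          ()
node₁ (comp f g) ()
node₁ (pr f g)   ()
node₁ (rec f g)  ()

Preimage : Code → ℕ → Code → Set
Preimage s n c′ = Σ Code λ c → encode c ≡ n × c′ ≡ replaceQ s c

preimage₂ : ∀ {s f g a b} t (con : Code → Code → Code) →
            (∀ x y → encode (con x y) ≡ pair t (pair (encode x) (encode y))) →
            (∀ x y → replaceQ s (con x y) ≡ con (replaceQ s x) (replaceQ s y)) →
            Preimage s a f → Preimage s b g → Preimage s (pair t (pair a b)) (con f g)
preimage₂ t con encode-con replaceQ-con (cf , ef , f≡) (cg , eg , g≡) =
  con cf cg , trans (encode-con cf cg) (cong₂ (λ u v → pair t (pair u v)) ef eg) ,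
  trans (cong₂ con f≡ g≡) (sym (replaceQ-con cf cg))

-- The recursion follows c′; the shape of n determines the constructor of c′,
-- and for compound codes the components are handled recursively.
replaceQ#-inverse : ∀ s c′ n → encode c′ ≡ replaceQ# (encode s) n → Preimage s n c′
inverse-binary : ∀ s c′ {t} → BinaryTag t → ∀ a b →
                 encode c′ ≡ pair t (pair (replaceQ# (encode s) a) (replaceQ# (encode s) b)) →
                 Preimage s (pair t (pair a b)) c′
inverse-children : ∀ s f g a b → pair (encode f) (encode g) ≡ pair (replaceQ# (encode s) a) (replaceQ# (encode s) b) →
                   Preimage s a f × Preimage s b g
inverse-mu : ∀ s c′ r → encode c′ ≡ pair 9 (replaceQ# (encode s) r) → Preimage s (pair 9 r) c′

replaceQ#-inverse s c′ n e with shape n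
... | query-shape refl = Q , refl , encode-injective c′ s (trans e (replaceQ#-pair (encode s) 5 0))
... | binary-shape bt a b refl = inverse-binary s c′ bt a b (trans e (replaceQ#-binary (encode s) bt a b))
... | mu-shape r refl = inverse-mu s c′ r (trans e (replaceQ#-mu (encode s) r))
... | other-shape fixed atoms = c′ , e′ , sym (replaceQ-atom (atoms c′ e′))
  where
  e′ : encode c′ ≡ n
  e′ = trans e (fixed (encode s))

inverse-binary s c′ {t} bt a b e with node₂ c′ (tag-of c′ t _ e) bt
... | comp-node f g = uncurry (preimage₂ 6 comp (λ _ _ → refl) (λ _ _ → refl)) (inverse-children s f g a b (rest-of (comp f g) 6 _ e))
... | pr-node f g   = uncurry (preimage₂ 7 pr   (λ _ _ → refl) (λ _ _ → refl)) (inverse-children s f g a b (rest-of (pr f g) 7 _ e))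
... | rec-node f g  = uncurry (preimage₂ 8 rec  (λ _ _ → refl) (λ _ _ → refl)) (inverse-children s f g a b (rest-of (rec f g) 8 _ e))

inverse-children s f g a b e =
  replaceQ#-inverse s f a (pair-injectiveˡ {encode f} {encode g} {replaceQ# (encode s) a} e) ,
  replaceQ#-inverse s g b (pair-injectiveʳ {encode f} {encode g} {replaceQ# (encode s) a} e)

inverse-mu s c′ r e with node₁ c′ (tag-of c′ 9 (replaceQ# (encode s) r) e)
... | mu-node f with cf , ef , f≡ ← replaceQ#-inverse s f r (rest-of (mu f) 9 (replaceQ# (encode s) r) e) = mu cf , cong (pair 9) ef , cong mu f≡

-- They are opaque, so that index expressions built from them
-- are compared without unfolding the pairing function.
opaque
  comp# pr# : ℕ → ℕ → ℕ
  comp# a b = pair 6 (pair a b)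
  pr#   a b = pair 7 (pair a b)

  comp#-pair : ∀ a b → comp# a b ≡ pair 6 (pair a b)
  comp#-pair a b = refl

  encode-comp : ∀ f g → encode (comp f g) ≡ comp# (encode f) (encode g)
  encode-comp f g = refl

  pr#-pair : ∀ a b → pr# a b ≡ pair 7 (pair a b)
  pr#-pair a b = refl

  encode-pr : ∀ f g → encode (pr f g) ≡ pr# (encode f) (encode g)
  encode-pr f g = refl

comp#F pr#F : Fn → Fn → Fn
comp#F F G = extF (pairF (constF 6) (pairF F G)) (λ x → comp# (fun F x) (fun G x)) (λ x → sym (comp#-pair _ _))
pr#F   F G = extF (pairF (constF 7) (pairF F G)) (λ x → pr# (fun F x) (fun G x)) (λ x → sym (pr#-pair _ _))

stdΦ-comp : ∀ {a b O x y} → stdΦ (comp# a b) O x y ⇔ (Σ ℕ λ m → stdΦ b O x m × stdΦ a O m y)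
stdΦ-comp {a} {b} = mk⇔ split
  (λ { (m , (g , eg , dg) , (f , ef , df)) → comp f g , trans (encode-comp f g) (cong₂ comp# ef eg) , evComp dg df })
  where
  split : ∀ {O x y} → stdΦ (comp# a b) O x y → Σ ℕ λ m → stdΦ b O x m × stdΦ a O m y
  split (d , ed , dd) with node₂ d (tag-of d 6 (pair a b) (trans ed (comp#-pair a b))) tag6
  ... | comp-node f g with m , dg , df ← eval-comp⁻¹ dd =
    m , (g , pair-injectiveʳ {encode f} {encode g} {a} r , dg) , (f , pair-injectiveˡ {encode f} {encode g} {a} r , df)
    where
    r : pair (encode f) (encode g) ≡ pair a b
    r = rest-of (comp f g) 6 (pair a b) (trans ed (comp#-pair a b))

stdΦ-Fn : ∀ (F : Fn) {O x y} → stdΦ (encode (code F)) O x y ⇔ (y ≡ fun F x)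
stdΦ-Fn F = mk⇔ (λ { (c , ec , dc) → eval-deterministic (subst (λ c → Eval c _ _ _) (encode-injective c (code F) ec) dc) (computes F _) refl })
                (λ { refl → code F , refl , computes F _ })

stdΦ-∘L : ∀ {a O j n y} → stdΦ (comp# a (encode L)) O (pair j n) y ⇔ stdΦ a O j y
stdΦ-∘L {a} {O} {j} {n} = mk⇔
  (λ c → let k , L-run , a-run = Equivalence.to stdΦ-comp c
         in subst (λ k → stdΦ a O k _) (trans (Equivalence.to (stdΦ-Fn fstF) L-run) (fst-pair j n)) a-run)
  (λ a-run → Equivalence.from stdΦ-comp (j , (L , refl , evL-pair j n) , a-run))

stdΦ-replaceQ# : ∀ {s O O′} → (∀ y → Eval s O y (b2n (O′ y))) →
                 ∀ e {x y} → stdΦ (replaceQ# (encode s) e) O x y ⇔ stdΦ e O′ x y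
stdΦ-replaceQ# {s} s-computes e = mk⇔
  (λ { (c′ , ec′ , dc′) → let c , ec , c′≡ = replaceQ#-inverse s c′ e ec′ in
         c , ec , replaceQ-complete s-computes c (subst (λ d → Eval d _ _ _) c′≡ dc′) })
  (λ { (c , refl , dc) → replaceQ s c , sym (replaceQ#-correct s c) , replaceQ-sound s-computes dc })

InJump : PNumbering → FNumbering → Oracle → ℕ → ℕ → ℕ → Set
InJump ψ Ψ X e i j = Σ ℕ λ u → ψ i j u × Σ ℕ λ y → Ψ e (restrict X u) j y

module Reduction (ψ : PNumbering) (Ψ : FNumbering) (accP : AcceptableP ψ) (accF : AcceptableF Ψ)
                 (A B : Oracle) (A≤B : BoundedTuringRed ψ Ψ A B) where

  open Equivalence using (to; from)

  φ-of ψ-of Φ-of Ψ-of : ℕ → ℕ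
  φ-of = proj₁ (proj₁ accP)
  ψ-of = proj₁ (proj₂ accP)
  Φ-of = proj₁ (proj₁ accF)
  Ψ-of = proj₁ (proj₂ accF)

  ψ⇔φ : ∀ e x y → ψ e x y ⇔ stdφ (φ-of e) x y
  ψ⇔φ = proj₂ (proj₂ (proj₁ accP))

  φ⇔ψ : ∀ e x y → stdφ e x y ⇔ ψ (ψ-of e) x y
  φ⇔ψ = proj₂ (proj₂ (proj₂ accP))

  Ψ⇔Φ : ∀ e O x y → Ψ e O x y ⇔ stdΦ (Φ-of e) O x y
  Ψ⇔Φ = proj₂ (proj₂ (proj₁ accF))

  Φ⇔Ψ : ∀ e O x y → stdΦ e O x y ⇔ Ψ (Ψ-of e) O x y
  Φ⇔Ψ = proj₂ (proj₂ (proj₂ accF))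

  φ-ofF ψ-ofF Φ-ofF Ψ-ofF : Fn
  φ-ofF = computableF (proj₁ (proj₂ (proj₁ accP)))
  ψ-ofF = computableF (proj₁ (proj₂ (proj₂ accP)))
  Φ-ofF = computableF (proj₁ (proj₂ (proj₁ accF)))
  Ψ-ofF = computableF (proj₁ (proj₂ (proj₂ accF)))

  i₀ j₀ : ℕ
  i₀ = proj₁ A≤B
  j₀ = proj₁ (proj₂ A≤B)

  use-spec : ∀ x → Σ ℕ λ u → ψ j₀ x u × Ψ i₀ (restrict B u) x (b2n (A x))
  use-spec = proj₂ (proj₂ (proj₂ A≤B))

  use : ℕ → ℕ
  use x = proj₁ (use-spec x)

  useF : Fn
  useF = indexF use (λ x → to (ψ⇔φ j₀ x (use x)) (proj₁ (proj₂ (use-spec x))))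

  decision : Σ Code λ c → ∀ x → Eval c (restrict B (use x)) x (b2n (A x))
  decision = common-code (λ c x → Eval c (restrict B (use x)) x (b2n (A x)))
                         (λ x → to (Ψ⇔Φ i₀ _ x _) (proj₂ (proj₂ (use-spec x))))

  -- useSum u bounds the uses of all arguments up to u, computably in u.
  useSum : ℕ → ℕ
  useSum zero    = use 0
  useSum (suc u) = useSum u + use (suc u)

  use≤useSum : ∀ {x u} → x ≤ u → use x ≤ useSum u
  use≤useSum {zero}  {zero}  _ = ≤-refl
  use≤useSum {x}     {suc u} x≤1+u with m≤n⇒m<n∨m≡n x≤1+u
  ... | inj₁ (s≤s x≤u) = ≤-trans (use≤useSum x≤u) (m≤m+n _ _)
  ... | inj₂ refl      = m≤n+m _ _

  useSumF : Fn
  useSumF = sealF (extF (recF (useF ∘F zeroF) ((sndF ∘F sndF) +F (useF ∘F sucF ∘F fstF ∘F sndF)) ∘F pairF zeroF idF) useSum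
    (λ u → trans (cong₂ (primRec (λ _ → use 0) step) (fst-pair 0 u) (snd-pair 0 u)) (correct u)))
    where
    step : ℕ → ℕ
    step q = snd (snd q) + use (suc (fst (snd q)))
    correct : ∀ u → primRec (λ _ → use 0) step 0 u ≡ useSum u
    correct zero    = refl
    correct (suc u) = cong₂ (λ s k → s + use (suc k)) (trans (third 0 u _) (correct u)) (second 0 u _)

  boundedQuery : Code
  boundedQuery = guarded (comp Q R) (code (sndF ≤F (useF ∘F fstF)))

  boundedQuery-computes : ∀ {x u′} → use x ≤ u′ → ∀ z →
                          Eval boundedQuery (restrict B u′) (pair x z) (b2n (restrict B (use x) z))
  boundedQuery-computes {x} {u′} use≤u′ z = guarded-restrict B (use x) z compare query
    where
    compare : Eval (code (sndF ≤F (useF ∘F fstF))) (restrict B u′) (pair x z) (1 ∸ (z ∸ use x))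
    compare = subst (Eval _ _ (pair x z)) (cong₂ (λ a b → 1 ∸ (a ∸ use b)) (snd-pair x z) (fst-pair x z))
                    (computes (sndF ≤F (useF ∘F fstF)) (pair x z))
    query : z ≤ use x → Eval (comp Q R) (restrict B u′) (pair x z) (b2n (B z))
    query z≤use = subst (Eval (comp Q R) _ (pair x z)) (cong b2n (restrict-≤ B (≤-trans z≤use use≤u′)))
                        (evComp (evR-pair x z) evQ)

  decideA : Code
  decideA = comp (withParam boundedQuery (proj₁ decision)) (pr I I)

  decideA-computes : ∀ {y u′} → use y ≤ u′ → Eval decideA (restrict B u′) y (b2n (A y))
  decideA-computes {y} {u′} use≤u′ = evComp (evPr evI evI)
    (withParam-sound {O = restrict B u′} {O′ = restrict B (use y)} {x = y} (boundedQuery-computes use≤u′) (proj₂ decision y))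

  restrictedA : Code
  restrictedA = seal (guarded (comp decideA L) (code (fstF ≤F sndF)))

  restrictedA-computes : ∀ y u → Eval restrictedA (restrict B (useSum u)) (pair y u) (b2n (restrict A u y))
  restrictedA-computes y u = seal-eval (guarded-restrict A u y compare
    (λ y≤u → evComp (evL-pair y u) (decideA-computes (use≤useSum y≤u))))
    where
    compare : Eval (code (fstF ≤F sndF)) (restrict B (useSum u)) (pair y u) (1 ∸ (y ∸ u))
    compare = subst (Eval _ _ (pair y u)) (cong₂ (λ a b → 1 ∸ (a ∸ b)) (fst-pair y u) (snd-pair y u))
                    (computes (fstF ≤F sndF) (pair y u))

  simulation : Code → ℕ → Code
  simulation c j = comp restrictedA (pr I (comp (replaceQ Z c) (constCode j)))

  simulation-computes : ∀ {c j u} → Eval c emptyOracle j u →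
                        ∀ y → Eval (simulation c j) (restrict B (useSum u)) y (b2n (restrict A u y))
  simulation-computes {j = j} {u} c-run y =
    evComp (evPr evI (evComp (constCode-eval j y) (emptyOracle-free c-run))) (restrictedA-computes y u)

  simulation# : ℕ → ℕ → ℕ
  simulation# m j = comp# (encode restrictedA) (pr# (encode I) (comp# (replaceQ# (encode Z) m) (encode (constCode j))))

  simulation#-encode : ∀ c j → simulation# (encode c) j ≡ encode (simulation c j)
  simulation#-encode c j = sym (begin
    encode (simulation c j)
      ≡⟨ encode-comp restrictedA (pr I (comp (replaceQ Z c) (constCode j))) ⟩
    comp# (encode restrictedA) (encode (pr I (comp (replaceQ Z c) (constCode j))))
      ≡⟨ cong (comp# (encode restrictedA)) (encode-pr I (comp (replaceQ Z c) (constCode j))) ⟩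
    comp# (encode restrictedA) (pr# (encode I) (encode (comp (replaceQ Z c) (constCode j))))
      ≡⟨ cong (λ v → comp# _ (pr# _ v)) (encode-comp (replaceQ Z c) (constCode j)) ⟩
    comp# (encode restrictedA) (pr# (encode I) (comp# (encode (replaceQ Z c)) (encode (constCode j))))
      ≡⟨ cong (λ v → comp# _ (pr# _ (comp# v _))) (sym (replaceQ#-correct Z c)) ⟩
    simulation# (encode c) j ∎)
    where open ≡-Reasoning

  bound# : ℕ → ℕ
  bound# i = comp# (encode (code useSumF)) (comp# (φ-of i) (encode L))

  jump# : ℕ → ℕ → ℕ → ℕ
  jump# e i j = comp# (replaceQ# (simulation# (φ-of i) j) (Φ-of e)) (encode L)

  bound-index : ∀ i j n u′ → stdφ (bound# i) (pair j n) u′ ⇔ (Σ ℕ λ u → stdφ (φ-of i) j u × u′ ≡ useSum u)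
  bound-index i j n u′ = mk⇔
    (λ run → let u , φ-run , sum-run = to stdΦ-comp run
             in u , to stdΦ-∘L φ-run , to (stdΦ-Fn useSumF) sum-run)
    (λ { (u , φ-run , refl) → from stdΦ-comp (u , from stdΦ-∘L φ-run , from (stdΦ-Fn useSumF) refl) })

  jump-index : ∀ e i j n {u y} → stdφ (φ-of i) j u →
               stdΦ (jump# e i j) (restrict B (useSum u)) (pair j n) y ⇔ stdΦ (Φ-of e) (restrict A u) j y
  jump-index e i j n {u} {y} (c , c# , c-run) = ⇔-trans stdΦ-∘L
    (subst (λ s → stdΦ (replaceQ# s (Φ-of e)) (restrict B (useSum u)) j y ⇔ stdΦ (Φ-of e) (restrict A u) j y)
           (sym (trans (cong (λ m → simulation# m j) (sym c#)) (simulation#-encode c j)))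
           (stdΦ-replaceQ# (simulation-computes c-run) (Φ-of e)))

  core : ∀ e i j n → InJump ψ Ψ B (Ψ-of (jump# e i j)) (ψ-of (bound# i)) (pair j n) ⇔ InJump ψ Ψ A e i j
  core e i j n = mk⇔ backward forward
    where
    forward : InJump ψ Ψ A e i j → InJump ψ Ψ B (Ψ-of (jump# e i j)) (ψ-of (bound# i)) (pair j n)
    forward (u , ψ-run , y , Ψ-run) =
      useSum u , to (φ⇔ψ (bound# i) (pair j n) (useSum u)) (from (bound-index i j n (useSum u)) (u , φ-run , refl)) ,
      y , to (Φ⇔Ψ (jump# e i j) (restrict B (useSum u)) (pair j n) y)
             (from (jump-index e i j n φ-run) (to (Ψ⇔Φ e (restrict A u) j y) Ψ-run))
      where
      φ-run : stdφ (φ-of i) j u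
      φ-run = to (ψ⇔φ i j u) ψ-run

    backward : InJump ψ Ψ B (Ψ-of (jump# e i j)) (ψ-of (bound# i)) (pair j n) → InJump ψ Ψ A e i j
    backward (u′ , ψ-run , y , Ψ-run) =
      u , from (ψ⇔φ i j u) φ-run ,
      y , from (Ψ⇔Φ e (restrict A u) j y) (to (jump-index e i j n φ-run) (from (Φ⇔Ψ (jump# e i j) (restrict B (useSum u)) (pair j n) y) Ψ-run′))
      where
      bound : Σ ℕ λ u → stdφ (φ-of i) j u × u′ ≡ useSum u
      bound = to (bound-index i j n u′) (from (φ⇔ψ (bound# i) (pair j n) u′) ψ-run)
      u : ℕ
      u = proj₁ bound
      φ-run : stdφ (φ-of i) j u
      φ-run = proj₁ (proj₂ bound)
      Ψ-run′ : Ψ (Ψ-of (jump# e i j)) (restrict B (useSum u)) (pair j n) y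
      Ψ-run′ = subst (λ v → Ψ (Ψ-of (jump# e i j)) (restrict B v) (pair j n) y) (proj₂ (proj₂ bound)) Ψ-run

  reductionAt : ℕ → ℕ → ℕ → ℕ → ℕ
  reductionAt e i j n = triple (Ψ-of (jump# e i j)) (ψ-of (bound# i)) (pair j n)

  reduction : ℕ → ℕ
  reduction n = reductionAt (fst n) (fst (snd n)) (snd (snd n)) n

  reductionF : Fn
  reductionF = extF (pairF jumpF (pairF boundF (pairF jF idF))) reduction (λ n → refl)
    where
    eF iF jF simulationF jumpF boundF : Fn
    eF = fstF
    iF = fstF ∘F sndF
    jF = sndF ∘F sndF
    simulationF = comp#F (constF (encode restrictedA))
                         (pr#F (constF (encode I)) (comp#F (replaceQ#₂ (constF (encode Z)) (φ-ofF ∘F iF)) (constCode#F ∘F jF)))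
    jumpF = Ψ-ofF ∘F comp#F (replaceQ#₂ simulationF (Φ-ofF ∘F eF)) (constF (encode L))
    boundF = ψ-ofF ∘F comp#F (constF (encode (code useSumF))) (comp#F (φ-ofF ∘F iF) (constF (encode L)))

  reduction-computable : Computable reduction
  reduction-computable = encode (code reductionF) , λ x → code reductionF , refl , computes reductionF x

  -- n is the last component of reduction n.
  reduction-injective : ∀ a b → reduction a ≡ reduction b → a ≡ b
  reduction-injective a b eq = trans (sym (recover a)) (trans (cong (λ m → snd (snd (snd m))) eq) (recover b))
    where
    recover : ∀ n → snd (snd (snd (reduction n))) ≡ n
    recover n = trans (cong snd (third e′ i′ (pair (snd (snd n)) n))) (snd-pair (snd (snd n)) n)
      where
      e′ i′ : ℕ
      e′ = Ψ-of (jump# (fst n) (fst (snd n)) (snd (snd n)))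
      i′ = ψ-of (bound# (fst (snd n)))

  reduction-triple : ∀ e i j → reduction (triple e i j) ≡ reductionAt e i j (triple e i j)
  reduction-triple e i j =
    trans (cong₂ (λ a b → reductionAt a b (snd (snd t)) t) (fst-pair e (pair i j)) (second e i j))
          (cong (λ c → reductionAt e i c t) (third e i j))
    where
    t : ℕ
    t = triple e i j

  reduction-correct : ∀ n → boundedJump ψ Ψ A n ⇔ boundedJump ψ Ψ B (reduction n)
  reduction-correct n = mk⇔ forward backward
    where
    forward : boundedJump ψ Ψ A n → boundedJump ψ Ψ B (reduction n)
    forward (e , i , j , refl , member) =
      Ψ-of (jump# e i j) , ψ-of (bound# i) , pair j n , reduction-triple e i j , from (core e i j n) member

    backward : boundedJump ψ Ψ B (reduction n) → boundedJump ψ Ψ A n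
    backward (e′ , i′ , j′ , eq , member)
      with refl , refl , refl ← triple-injective {Ψ-of (jump# (fst n) (fst (snd n)) (snd (snd n)))}
                                                 {ψ-of (bound# (fst (snd n)))} {pair (snd (snd n)) n} {e′} {i′} {j′} eq =
      fst n , fst (snd n) , snd (snd n) , sym (triple-components n) , to (core (fst n) (fst (snd n)) (snd (snd n)) n) member

  oneReduction : OneRed (boundedJump ψ Ψ A) (boundedJump ψ Ψ B)
  oneReduction = reduction , reduction-computable , reduction-injective , reduction-correct

mainTheorem5 : (ψ : PNumbering) (Ψ : FNumbering) → AcceptableP ψ → AcceptableF Ψ →
               (A B : Oracle) → BoundedTuringRed ψ Ψ A B →
               OneRed (boundedJump ψ Ψ A) (boundedJump ψ Ψ B)
mainTheorem5 ψ Ψ accP accF A B A≤B = Reduction.oneReduction ψ Ψ accP accF A B A≤B
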